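{- Let $G=(V,E)$ be a connected block graph with at least three vertices, and let $\mathcal B$ be its set of maximal cliques. Compute a partial coloring $c'$ of $V$ with colors black and white as follows: (1) color every vertex of degree $1$ in $G$ black; (2) repeat exhaustively: if some $B\in\mathcal B$ has exactly one uncolored vertex $v$ and all other vertices of $B$ have the same color, color $v$ with the opposite color. Let $G'$ be the graph obtained from $G$ by deleting every edge both of whose endpoints are colored by $c'$ with the same color. Then every spanning even tree $T$ of $G$ is a subgraph of $G'$.
   Context: All graphs are finite and simple. A block graph is a graph in which every biconnected component induces a clique. A leaf of a tree is a vertex of degree $1$. A tree is even if for every pair of distinct leaves, the number of edges of the unique path between them is even; a spanning even tree of $G$ is a spanning tree that is even. -}

module Defs where

open import Data.Nat using (ℕ; zero; suc)
open import Data.Nat.Divisibility using (_∣_)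
open import Data.Fin using (Fin)
open import Data.Bool using (Bool; true; false)
open import Data.Maybe using (Maybe; just; nothing)
open import Data.List using (List; []; _∷_; _++_; [_]; length)
open import Data.List.Relation.Unary.Linked using (Linked)
open import Data.List.Relation.Unary.All using (All)
open import Data.List.Relation.Unary.Unique.Propositional using (Unique)
open import Data.Product using (Σ; ∃; ∃-syntax; _×_)
open import Relation.Binary.PropositionalEquality using (_≡_; _≢_)
open import Relation.Nullary using (¬_)

record Graph (n : ℕ) : Set where
  field
    adj   : Fin n → Fin n → Bool
    sym   : ∀ u v → adj u v ≡ adj v u
    irrefl : ∀ v → adj v v ≡ false
open Graph public

module _ {n : ℕ} (G : Graph n) where

  Adj : Fin n → Fin n → Set
  Adj u v = adj G u v ≡ true

  VSet : Set₁
  VSet = Fin n → Set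

  _⊆_ : VSet → VSet → Set
  S ⊆ S' = ∀ x → S x → S' x

  data WalkIn (S : VSet) : Fin n → Fin n → Set where
    here : ∀ {u} → S u → WalkIn S u u
    step : ∀ {u w v} → S u → Adj u w → WalkIn S w v → WalkIn S u v

  ConnectedIn : VSet → Set
  ConnectedIn S = ∀ u v → S u → S v → WalkIn S u v

  Connected : Set
  Connected = ConnectedIn (λ _ → Data.Unit.⊤)
    where import Data.Unit

  Deg1 : Fin n → Set
  Deg1 u = Σ (Fin n) λ w → Adj u w × (∀ x → Adj u x → x ≡ w)

  -- G[S] is biconnected: at least two vertices, connected, and no cut vertex
  -- (bridges, i.e. K2's, count as biconnected)
  Biconnected : VSet → Set
  Biconnected S =
    (∃ λ x → ∃ λ y → x ≢ y × S x × S y)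
    × ConnectedIn S
    × (∀ x → S x → ConnectedIn (λ y → S y × y ≢ x))

  BiconnectedComponent : VSet → Set₁
  BiconnectedComponent S =
    Biconnected S × (∀ S' → S ⊆ S' → Biconnected S' → S' ⊆ S)

  Clique : VSet → Set
  Clique S = ∀ x y → S x → S y → x ≢ y → Adj x y

  MaximalClique : VSet → Set₁
  MaximalClique S = Clique S × (∀ S' → S ⊆ S' → Clique S' → S' ⊆ S)

  IsBlockGraph : Set₁
  IsBlockGraph = ∀ S → BiconnectedComponent S → Clique S

  HasCycle : Set
  HasCycle = ∃ λ x → ∃ λ y → ∃ λ z → Σ (List (Fin n)) λ rest →
    Unique (x ∷ y ∷ z ∷ rest) × Linked Adj ((x ∷ y ∷ z ∷ rest) ++ [ x ])

  IsTree : Set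
  IsTree = Connected × ¬ HasCycle

  -- a path from u to v: u ∷ ps ++ [v] with distinct vertices and consecutive
  -- vertices adjacent; it has (length ps + 1) edges
  IsPath : Fin n → Fin n → List (Fin n) → Set
  IsPath u v ps = Unique (u ∷ ps ++ [ v ]) × Linked Adj (u ∷ ps ++ [ v ])

  IsEven : Set
  IsEven = ∀ u v → Deg1 u → Deg1 v → u ≢ v →
           ∀ ps → IsPath u v ps → 2 ∣ suc (length ps)

_⊑_ : ∀ {n} → Graph n → Graph n → Set
T ⊑ G = ∀ u v → Adj T u v → Adj G u v

IsSpanningEvenTree : ∀ {n} → Graph n → Graph n → Set
IsSpanningEvenTree G T = (T ⊑ G) × IsTree T × IsEven T

data Colour : Set where
  black white : Colour

opposite : Colour → Colour
opposite black = white
opposite white = black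

PartialColouring : ℕ → Set
PartialColouring n = Fin n → Maybe Colour

module _ {n : ℕ} (G : Graph n) where

  InitialColouring : PartialColouring n → Set
  InitialColouring c = ∀ v → (Deg1 G v → c v ≡ just black) × (¬ Deg1 G v → c v ≡ nothing)

  Applicable : PartialColouring n → (Fin n → Set) → Fin n → Colour → Set₁
  Applicable c B v col =
    MaximalClique G B × B v × c v ≡ nothing × (∀ u → B u → u ≢ v → c u ≡ just col)

  Step : PartialColouring n → PartialColouring n → Set₁
  Step c c' = Σ (Fin n → Set) λ B → Σ (Fin n) λ v → Σ Colour λ col →
    Applicable c B v col × c' v ≡ just (opposite col) × (∀ u → u ≢ v → c' u ≡ c u)

  data Run : PartialColouring n → PartialColouring n → Set₁ where
    done : ∀ {c} → Run c c
    next : ∀ {c c' c''} → Step c c' → Run c' c'' → Run c c''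

  Terminal : PartialColouring n → Set₁
  Terminal c = ∀ B v col → ¬ Applicable c B v col

  IsOutput : PartialColouring n → Set₁
  IsOutput c' = ∃ λ c → InitialColouring c × Run c c' × Terminal c'

  EdgeOfG' : PartialColouring n → Fin n → Fin n → Set
  EdgeOfG' c' u v = Adj G u v × ¬ (Σ Colour λ col → c' u ≡ just col × c' v ≡ just col)

-- A spanning tree T is bipartite, so it has a proper 2-colouring f; as T is even, all leaves of T,
-- and with them all leaves of G, get the same colour, which we take to be black. Every vertex the
-- procedure colours then receives its f-colour: were a rule to fire on a maximal clique B against f,
-- B would be f-monochromatic with at least two vertices. The T-path between two vertices of B,
-- closed by their G-edge, is a cycle of G, so it lies in a block, a clique containing B and hence
-- equal to B; so the T-neighbour of the first vertex on that path lies in B with the other colour.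
-- Finally f is proper on T, so no edge of T joins two vertices of the same c'-colour.

module Submission where

open import Defs hiding (sym)
open import Data.Nat using (ℕ; zero; suc; _+_; _*_; _≤_; _<_; _≥_; s≤s)
open import Data.Nat.Properties using (+-suc; m≤m+n; m≤n+m; n≤1+n; ≤-trans; ≤-reflexive)
open import Data.Nat.Divisibility using (_∣_; divides)
open import Data.Nat.Induction using (<-rec)
open import Data.Fin using (Fin)
open import Data.Fin.Properties using (_≟_)
open import Data.Fin.Subset using (Subset; _⊂_; _⊃_) renaming (_∈_ to _∈ₛ_)
open import Data.Fin.Subset.Properties using (_∈?_)
open import Data.Fin.Subset.Induction using (Acc; acc; ⊃-wellFounded)
open import Data.Vec using (tabulate)
open import Data.Vec.Properties using (lookup∘tabulate; []=⇒lookup; lookup⇒[]=)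
open import Data.Maybe using (just)
open import Data.Maybe.Properties using (just-injective)
open import Data.List using (List; []; _∷_; _++_; [_]; length)
open import Data.List.Properties using (++-assoc)
open import Data.List.Relation.Unary.Linked as Linked using (Linked; []; [-]; _∷_)
open import Data.List.Relation.Unary.All as All using (All; []; _∷_)
open import Data.List.Relation.Unary.All.Properties using (¬Any⇒All¬)
open import Data.List.Relation.Unary.Any using (here; there)
open import Data.List.Relation.Unary.AllPairs using ([]; _∷_)
open import Data.List.Relation.Unary.Unique.Propositional using (Unique)
open import Data.List.Membership.Propositional using (_∈_)
open import Data.List.Membership.Propositional.Properties using (∈-++⁺ˡ; ∈-++⁺ʳ; ∈-++⁻; ∈-∃++)
open import Data.Product using (∃; _×_; _,_; proj₁; proj₂)
open import Data.Sum using (_⊎_; inj₁; inj₂)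
open import Data.Empty using (⊥; ⊥-elim)
open import Data.Unit using (tt)
open import Relation.Binary.Definitions using (DecidableEquality)
open import Relation.Binary.PropositionalEquality using (_≡_; _≢_; refl; sym; trans; cong; subst; module ≡-Reasoning)
open import Relation.Nullary using (¬_; Dec; yes; no; does)
open import Relation.Nullary.Negation using (¬¬-map; negated-stable)
open import Relation.Nullary.Decidable using (¬¬-excluded-middle; decidable-stable)

open ≡-Reasoning

-- Blocks exist only classically. Every use below ends in ⊥ or a decidable goal, so the double
-- negation monad suffices; the library's ¬¬-Monad is level-homogeneous, hence this bind.

infixl 1 _>>=_

_>>=_ : ∀ {a b} {A : Set a} {B : Set b} → ¬ ¬ A → (A → ¬ ¬ B) → ¬ ¬ B
m >>= f = negated-stable (¬¬-map f m)

return : ∀ {a} {A : Set a} → A → ¬ ¬ A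
return a ¬a = ¬a a

¬¬-finite-choice : ∀ m {P : Fin m → Set} → (∀ i → ¬ ¬ P i) → ¬ ¬ (∀ i → P i)
¬¬-finite-choice zero    _  = return λ ()
¬¬-finite-choice (suc m) ¬¬P = do
  p₀ ← ¬¬P Fin.zero
  ps ← ¬¬-finite-choice m (λ i → ¬¬P (Fin.suc i))
  return λ { Fin.zero → p₀ ; (Fin.suc i) → ps i }

opposite-involutive : ∀ c → opposite (opposite c) ≡ c
opposite-involutive black = refl
opposite-involutive white = refl

opposite-≢ : ∀ c → c ≢ opposite c
opposite-≢ black ()
opposite-≢ white ()

≢⇒≡opposite : ∀ {c d} → c ≢ d → d ≡ opposite c
≢⇒≡opposite {black} {black} c≢d = ⊥-elim (c≢d refl)
≢⇒≡opposite {black} {white} _   = refl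
≢⇒≡opposite {white} {black} _   = refl
≢⇒≡opposite {white} {white} c≢d = ⊥-elim (c≢d refl)

_≟ᶜ_ : DecidableEquality Colour
black ≟ᶜ black = yes refl
black ≟ᶜ white = no λ ()
white ≟ᶜ black = no λ ()
white ≟ᶜ white = yes refl

flips : ℕ → Colour → Colour
flips zero    c = c
flips (suc k) c = opposite (flips k c)

flips-+ : ∀ a b c → flips (a + b) c ≡ flips a (flips b c)
flips-+ zero    b c = refl
flips-+ (suc a) b c = cong opposite (flips-+ a b c)

flips-opposite : ∀ k c → flips k (opposite c) ≡ opposite (flips k c)
flips-opposite zero    c = refl
flips-opposite (suc k) c = cong opposite (flips-opposite k c)

flips-involutive : ∀ k c → flips k (flips k c) ≡ c
flips-involutive zero    c = refl
flips-involutive (suc k) c = begin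
  opposite (flips k (opposite (flips k c))) ≡⟨ cong opposite (flips-opposite k (flips k c)) ⟩
  opposite (opposite (flips k (flips k c))) ≡⟨ opposite-involutive _ ⟩
  flips k (flips k c)                       ≡⟨ flips-involutive k c ⟩
  c                                         ∎

flips-even : ∀ k c → 2 ∣ k → flips k c ≡ c
flips-even _ c (divides q refl) = flips-*2 q
  where
  flips-*2 : ∀ q → flips (q * 2) c ≡ c
  flips-*2 zero    = refl
  flips-*2 (suc q) = trans (opposite-involutive _) (flips-*2 q)

flips-odd-+ : ∀ a b c → flips (a + b) c ≢ c → flips a c ≢ c ⊎ flips b c ≢ c
flips-odd-+ a b c odd with flips b c ≟ᶜ c
... | no  b-odd = inj₂ b-odd
... | yes b-even = inj₁ λ a-even → odd (trans (flips-+ a b c) (trans (cong (flips a) b-even) a-even))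

unique-++-disjoint : ∀ {A : Set} {x : A} xs {ys} → Unique (xs ++ ys) → x ∈ xs → ¬ x ∈ ys
unique-++-disjoint (_ ∷ xs) (x≢ ∷ _) (here refl) x∈ys = All.lookup x≢ (∈-++⁺ʳ xs x∈ys) refl
unique-++-disjoint (_ ∷ xs) (_ ∷ u)  (there x∈xs) = unique-++-disjoint xs u x∈xs

linked-prefix : ∀ {A : Set} {R : A → A → Set} xs {z ys} → Linked R (xs ++ z ∷ ys) → Linked R (xs ++ [ z ])
linked-prefix []           _       = [-]
linked-prefix (_ ∷ [])     (r ∷ _) = r ∷ [-]
linked-prefix (_ ∷ _ ∷ xs) (r ∷ l) = r ∷ linked-prefix (_ ∷ xs) l

linked-suffix : ∀ {A : Set} {R : A → A → Set} xs {ys} → Linked R (xs ++ ys) → Linked R ys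
linked-suffix []       l = l
linked-suffix (_ ∷ xs) l = linked-suffix xs (Linked.tail l)

⟦_⟧ : ∀ {n} → Subset n → Fin n → Set
⟦ p ⟧ y = y ∈ₛ p

decSubset : ∀ {n} {P : Fin n → Set} → (∀ y → Dec (P y)) → Subset n
decSubset P? = tabulate (λ y → does (P? y))

decSubset⁺ : ∀ {n} {P : Fin n → Set} (P? : ∀ y → Dec (P y)) {y} → P y → y ∈ₛ decSubset P?
decSubset⁺ P? {y} Py with P? y | lookup∘tabulate (λ y → does (P? y)) y
... | yes _  | lookup≡ = lookup⇒[]= y _ lookup≡
... | no ¬Py | _       = ⊥-elim (¬Py Py)

decSubset⁻ : ∀ {n} {P : Fin n → Set} (P? : ∀ y → Dec (P y)) {y} → y ∈ₛ decSubset P? → P y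
decSubset⁻ P? {y} y∈ with P? y | trans (sym (lookup∘tabulate _ y)) ([]=⇒lookup y∈)
... | yes Py | _ = Py
... | no _   | ()

module _ {n : ℕ} (G : Graph n) where

  open import Data.List.Membership.DecPropositional (_≟_ {n}) using () renaming (_∈?_ to _∈ᴸ?_)

  Adj-sym : ∀ {u v} → Adj G u v → Adj G v u
  Adj-sym {u} {v} uv = trans (sym (Graph.sym G u v)) uv

  Adj⇒≢ : ∀ {u v} → Adj G u v → u ≢ v
  Adj⇒≢ {u} uu refl with trans (sym uu) (irrefl G u)
  ... | ()

  walkIn-start : ∀ {S u v} → WalkIn G S u v → S u
  walkIn-start (here Su)     = Su
  walkIn-start (step Su _ _) = Su

  walkIn-++ : ∀ {S u m v} → WalkIn G S u m → WalkIn G S m v → WalkIn G S u v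
  walkIn-++ (here _)      w′ = w′
  walkIn-++ (step Su a w) w′ = step Su a (walkIn-++ w w′)

  walkIn-reverse : ∀ {S u v} → WalkIn G S u v → WalkIn G S v u
  walkIn-reverse (here Su)     = here Su
  walkIn-reverse (step Su a w) = walkIn-++ (walkIn-reverse w) (step (walkIn-start w) (Adj-sym a) (here Su))

  walkIn-mono : ∀ {S S′ : Fin n → Set} → (∀ {y} → S y → S′ y) → ∀ {u v} → WalkIn G S u v → WalkIn G S′ u v
  walkIn-mono S⊆S′ (here Su)     = here (S⊆S′ Su)
  walkIn-mono S⊆S′ (step Su a w) = step (S⊆S′ Su) a (walkIn-mono S⊆S′ w)

  connectedIn-through : (R H : Fin n → Set) → (∀ s t → H s → H t → WalkIn G R s t) →
    (∀ z → R z → ∃ λ h → H h × WalkIn G R z h) → ConnectedIn G R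
  connectedIn-through R H H-conn reach p q Rp Rq with reach p Rp | reach q Rq
  ... | h , Hh , p⇝h | h′ , Hh′ , q⇝h′ = walkIn-++ p⇝h (walkIn-++ (H-conn h h′ Hh Hh′) (walkIn-reverse q⇝h′))

  linked⇒walkIn : ∀ {R : Fin n → Set} {xs} → Linked (Adj G) xs → All R xs →
    ∀ {z z′} → z ∈ xs → z′ ∈ xs → WalkIn G R z z′
  linked⇒walkIn _       (Rx ∷ _)  (here refl) (here refl) = here Rx
  linked⇒walkIn (a ∷ l) (Rx ∷ Rs) (here refl) (there m′) = step Rx a (linked⇒walkIn l Rs (here refl) m′)
  linked⇒walkIn (a ∷ l) (Rx ∷ Rs) (there m)   (here refl) =
    walkIn-reverse (step Rx a (linked⇒walkIn l Rs (here refl) m))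
  linked⇒walkIn (_ ∷ l) (_ ∷ Rs)  (there m)   (there m′) = linked⇒walkIn l Rs m m′

  clique⇒biconnected : ∀ {C} → Clique G C → (∃ λ x → ∃ λ y → x ≢ y × C x × C y) → Biconnected G C
  clique⇒biconnected {C} C-clique two = two , joined (λ Cy → Cy) , λ x _ → joined proj₁
    where
    joined : ∀ {R : Fin n → Set} → (∀ {y} → R y → C y) → ConnectedIn G R
    joined R⊆C p q Rp Rq with p ≟ q
    ... | yes refl = here Rp
    ... | no  p≢q  = step Rp (C-clique p q (R⊆C Rp) (R⊆C Rq) p≢q) (here Rq)

  biconnected-resp : ∀ {S S′ : Fin n → Set} → (∀ {y} → S y → S′ y) → (∀ {y} → S′ y → S y) →
    Biconnected G S → Biconnected G S′
  biconnected-resp to from ((x , y , x≢y , Sx , Sy) , S-conn , S-rem) =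
    (x , y , x≢y , to Sx , to Sy) ,
    (λ p q Sp Sq → walkIn-mono to (S-conn p q (from Sp) (from Sq))) ,
    (λ z Sz p q (Sp , p≢z) (Sq , q≢z) →
      walkIn-mono (λ (Sy , y≢z) → to Sy , y≢z) (S-rem z (from Sz) p q (from Sp , p≢z) (from Sq , q≢z)))

  path-interior-to-end : ∀ {a b qs x z} → IsPath G a b qs → z ∈ qs → z ≢ x →
    ∃ λ e → (e ≡ a ⊎ e ≡ b) × e ≢ x × WalkIn G (λ y → y ∈ a ∷ qs ++ [ b ] × y ≢ x) z e
  path-interior-to-end {a} {b} {x = x} {z} (unique , linked) z∈qs z≢x with ∈-∃++ z∈qs
  ... | p₁ , p₂ , refl rewrite ++-assoc p₁ (z ∷ p₂) [ b ] with x ∈ᴸ? (a ∷ p₁)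
  ... | no x∉ = a , inj₁ refl , (λ { refl → x∉ (here refl) }) ,
        linked⇒walkIn (linked-prefix (a ∷ p₁) linked) (All.tabulate on-prefix)
          (∈-++⁺ʳ (a ∷ p₁) (here refl)) (here refl)
    where
    on-prefix : ∀ {y} → y ∈ (a ∷ p₁) ++ [ z ] → y ∈ (a ∷ p₁) ++ z ∷ p₂ ++ [ b ] × y ≢ x
    on-prefix m with ∈-++⁻ (a ∷ p₁) m
    ... | inj₁ m′          = ∈-++⁺ˡ m′ , λ { refl → x∉ m′ }
    ... | inj₂ (here refl) = ∈-++⁺ʳ (a ∷ p₁) (here refl) , z≢x
  ... | yes x∈ = b , inj₂ refl , (λ { refl → x∉suffix (there (∈-++⁺ʳ p₂ (here refl))) }) ,
        linked⇒walkIn (linked-suffix (a ∷ p₁) linked) (All.tabulate on-suffix)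
          (here refl) (there (∈-++⁺ʳ p₂ (here refl)))
    where
    x∉suffix : ¬ x ∈ z ∷ p₂ ++ [ b ]
    x∉suffix = unique-++-disjoint (a ∷ p₁) unique x∈
    on-suffix : ∀ {y} → y ∈ z ∷ p₂ ++ [ b ] → y ∈ (a ∷ p₁) ++ z ∷ p₂ ++ [ b ] × y ≢ x
    on-suffix m = ∈-++⁺ʳ (a ∷ p₁) m , λ { refl → x∉suffix m }

  ear-biconnected : ∀ {S a b qs} → Biconnected G S → S a → S b → a ≢ b → IsPath G a b qs →
    All (λ y → ¬ S y) qs → Biconnected G (λ y → S y ⊎ y ∈ qs)
  ear-biconnected {S} {a} {b} {qs} ((x₀ , y₀ , x₀≢y₀ , Sx₀ , Sy₀) , S-conn , S-rem) Sa Sb a≢b path qs∉S =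
    (x₀ , y₀ , x₀≢y₀ , inj₁ Sx₀ , inj₁ Sy₀) , S′-conn , S′-rem
    where
    S′ : Fin n → Set
    S′ y = S y ⊎ y ∈ qs

    on-path : ∀ {y} → y ∈ a ∷ qs ++ [ b ] → S′ y
    on-path (here refl) = inj₁ Sa
    on-path (there m) with ∈-++⁻ qs m
    ... | inj₁ m′          = inj₂ m′
    ... | inj₂ (here refl) = inj₁ Sb

    S′-conn : ConnectedIn G S′
    S′-conn = connectedIn-through S′ S (λ s t Ss St → walkIn-mono inj₁ (S-conn s t Ss St)) reach
      where
      reach : ∀ z → S′ z → ∃ λ h → S h × WalkIn G S′ z h
      reach z (inj₁ Sz)  = z , Sz , here (inj₁ Sz)
      reach z (inj₂ z∈qs) = a , Sa , walkIn-mono on-path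
        (linked⇒walkIn (proj₂ path) (All.tabulate (λ m → m)) (there (∈-++⁺ˡ z∈qs)) (here refl))

    S′-rem : ∀ x → S′ x → ConnectedIn G (λ y → S′ y × y ≢ x)
    S′-rem x S′x = connectedIn-through _ (λ y → S y × y ≢ x) (core S′x) reach
      where
      core : S′ x → ∀ s t → S s × s ≢ x → S t × t ≢ x → WalkIn G (λ y → S′ y × y ≢ x) s t
      core (inj₁ Sx)   s t Hs Ht = walkIn-mono (λ (Sy , y≢x) → inj₁ Sy , y≢x) (S-rem x Sx s t Hs Ht)
      core (inj₂ x∈qs) s t Hs Ht = walkIn-mono (λ Sy → inj₁ Sy , λ { refl → All.lookup qs∉S x∈qs Sy })
        (S-conn s t (proj₁ Hs) (proj₁ Ht))
      reach : ∀ z → S′ z × z ≢ x → ∃ λ h → (S h × h ≢ x) × WalkIn G (λ y → S′ y × y ≢ x) z h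
      reach z (inj₁ Sz , z≢x) = z , (Sz , z≢x) , here (inj₁ Sz , z≢x)
      reach z (inj₂ z∈qs , z≢x) with path-interior-to-end path z∈qs z≢x
      ... | e , e∈ab , e≢x , z⇝e = e , (S-end e∈ab , e≢x) , walkIn-mono (λ (m , y≢x) → on-path m , y≢x) z⇝e
        where
        S-end : ∀ {e} → e ≡ a ⊎ e ≡ b → S e
        S-end (inj₁ refl) = Sa
        S-end (inj₂ refl) = Sb

  edge-clique : ∀ {u v} → Adj G u v → Clique G (λ y → y ≡ u ⊎ y ≡ v)
  edge-clique uv _ _ (inj₁ refl) (inj₁ refl) x≢y = ⊥-elim (x≢y refl)
  edge-clique uv _ _ (inj₁ refl) (inj₂ refl) _   = uv
  edge-clique uv _ _ (inj₂ refl) (inj₁ refl) _   = Adj-sym uv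
  edge-clique uv _ _ (inj₂ refl) (inj₂ refl) x≢y = ⊥-elim (x≢y refl)

  maximal-clique-not-singleton : Connected G → ∀ {B v w} → w ≢ v → MaximalClique G B → B v →
    ¬ (∀ {u} → B u → u ≡ v)
  maximal-clique-not-singleton G-connected {B} {v} {w} w≢v (_ , B-max) _ B⊆v with G-connected v w tt tt
  ... | here _              = w≢v refl
  ... | step {w = x} _ vx _ =
    Adj⇒≢ vx (sym (B⊆v (B-max _ (λ _ By → inj₁ (B⊆v By)) (edge-clique vx) x (inj₂ refl))))

  cycle-biconnected : ∀ {u v qs} → Adj G u v → IsPath G u v qs →
    Biconnected G (λ y → (y ≡ u ⊎ y ≡ v) ⊎ y ∈ qs)
  cycle-biconnected {u} {v} {qs} uv path@(unique@(u∉ ∷ _) , _) =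
    ear-biconnected (clique⇒biconnected (edge-clique uv) (u , v , Adj⇒≢ uv , inj₁ refl , inj₂ refl))
      (inj₁ refl) (inj₂ refl) (Adj⇒≢ uv) path (All.tabulate off-edge)
    where
    off-edge : ∀ {y} → y ∈ qs → ¬ (y ≡ u ⊎ y ≡ v)
    off-edge y∈qs (inj₁ refl) = All.lookup u∉ (∈-++⁺ˡ y∈qs) refl
    off-edge y∈qs (inj₂ refl) = unique-++-disjoint (u ∷ qs) unique (there y∈qs) (here refl)

  clique⊆component : ∀ {q B u v} → BiconnectedComponent G ⟦ q ⟧ → Clique G B → B u → B v → u ≢ v →
    ⟦ q ⟧ u → ⟦ q ⟧ v → ∀ {w} → B w → ⟦ q ⟧ w
  clique⊆component {q} {B} {u} {v} (q-bic , q-max) B-clique Bu Bv u≢v u∈q v∈q {w} Bw with w ∈? q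
  ... | yes w∈q = w∈q
  ... | no  w∉q = ⊥-elim (w∉q (q-max _ (λ _ → inj₁) q∪w-bic w (inj₂ (here refl))))
    where
    w≢u : w ≢ u
    w≢u refl = w∉q u∈q
    w≢v : w ≢ v
    w≢v refl = w∉q v∈q
    q∪w-bic : Biconnected G (λ y → ⟦ q ⟧ y ⊎ y ∈ [ w ])
    q∪w-bic = ear-biconnected q-bic u∈q v∈q u≢v
      ( ((λ u≡w → w≢u (sym u≡w)) ∷ u≢v ∷ []) ∷ (w≢v ∷ []) ∷ [] ∷ []
      , B-clique u w Bu Bw (λ u≡w → w≢u (sym u≡w)) ∷ B-clique w v Bw Bv w≢v ∷ [-] )
      (w∉q ∷ [])

-- Existence of biconnected components

  subset-maximal⇒component : ∀ p → Biconnected G ⟦ p ⟧ → ¬ (∃ λ q → p ⊂ q × Biconnected G ⟦ q ⟧) →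
    BiconnectedComponent G ⟦ p ⟧
  subset-maximal⇒component p p-bic no-larger = p-bic , λ S′ p⊆S′ S′-bic x S′x →
    decidable-stable (x ∈? p) do
      S′? ← ¬¬-finite-choice n (λ _ → ¬¬-excluded-middle)
      λ x∉p → no-larger
        ( decSubset S′?
        , ((λ y∈p → decSubset⁺ S′? (p⊆S′ _ y∈p)) , x , decSubset⁺ S′? S′x , x∉p)
        , biconnected-resp (decSubset⁺ S′?) (decSubset⁻ S′?) S′-bic )

  subset-component-containing : ∀ p → Acc _⊃_ p → Biconnected G ⟦ p ⟧ →
    ¬ ¬ (∃ λ q → (∀ {y} → ⟦ p ⟧ y → ⟦ q ⟧ y) × BiconnectedComponent G ⟦ q ⟧)
  subset-component-containing p (acc larger) p-bic =
    ¬¬-excluded-middle {A = ∃ λ q → p ⊂ q × Biconnected G ⟦ q ⟧} >>= λ where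
      (yes (q , p⊂q , q-bic)) → do
        (r , q⊆r , r-block) ← subset-component-containing q (larger p⊂q) q-bic
        return (r , (λ {_} y∈p → q⊆r (proj₁ p⊂q y∈p)) , r-block)
      (no no-larger) → return (p , (λ {_} y∈p → y∈p) , subset-maximal⇒component p p-bic no-larger)

  component-containing : ∀ {P} → Biconnected G P →
    ¬ ¬ (∃ λ q → (∀ {y} → P y → ⟦ q ⟧ y) × BiconnectedComponent G ⟦ q ⟧)
  component-containing P-bic = do
    P? ← ¬¬-finite-choice n (λ _ → ¬¬-excluded-middle)
    (q , P⊆q , q-block) ← subset-component-containing (decSubset P?) (⊃-wellFounded _)
      (biconnected-resp (decSubset⁺ P?) (decSubset⁻ P?) P-bic)
    return (q , (λ {_} Py → P⊆q (decSubset⁺ P? Py)) , q-block)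

module _ {n : ℕ} (G : Graph n) where

  infixr 5 _◅_

  data Walk : Fin n → Fin n → ℕ → Set where
    ε   : ∀ {u} → Walk u u 0
    _◅_ : ∀ {u w v k} → Adj G u w → Walk w v k → Walk u v (suc k)

  record Detour (u v : Fin n) (k : ℕ) : Set where
    field
      {centre}                  : Fin n
      {loop-length rest-length} : ℕ
      loop       : Walk centre centre (suc loop-length)
      rest       : Walk u v rest-length
      length-sum : suc loop-length + rest-length ≡ k

module _ {n : ℕ} {G : Graph n} where

  open import Data.List.Membership.DecPropositional (_≟_ {n}) using () renaming (_∈?_ to _∈ᴸ?_)

  infixl 5 _▻_

  walkIn⇒walk : ∀ {S u v} → WalkIn G S u v → ∃ (Walk G u v)
  walkIn⇒walk (here _)     = 0 , ε
  walkIn⇒walk (step _ a w) = let k , w′ = walkIn⇒walk w in suc k , a ◅ w′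

  _++ʷ_ : ∀ {u m v k₁ k₂} → Walk G u m k₁ → Walk G m v k₂ → Walk G u v (k₁ + k₂)
  ε       ++ʷ w′ = w′
  (a ◅ w) ++ʷ w′ = a ◅ (w ++ʷ w′)

  _▻_ : ∀ {u v w k} → Walk G u v k → Adj G v w → Walk G u w (suc k)
  ε       ▻ a = a ◅ ε
  (b ◅ w) ▻ a = b ◅ (w ▻ a)

  reverseʷ : ∀ {u v k} → Walk G u v k → Walk G v u k
  reverseʷ ε       = ε
  reverseʷ (a ◅ w) = reverseʷ w ▻ Adj-sym G a

  vertices : ∀ {u v k} → Walk G u v k → List (Fin n)
  later    : ∀ {u v k} → Walk G u v k → List (Fin n)
  vertices {u} w = u ∷ later w
  later ε       = []
  later (_ ◅ w) = vertices w

  vertices-linked : ∀ {u v k} (w : Walk G u v k) → Linked (Adj G) (vertices w)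
  vertices-linked ε       = [-]
  vertices-linked (a ◅ w) = a ∷ vertices-linked w

  vertices-▻ : ∀ {u v w k} (p : Walk G u v k) (a : Adj G v w) → vertices (p ▻ a) ≡ vertices p ++ [ w ]
  vertices-▻ ε           a = refl
  vertices-▻ {u} (b ◅ p) a = cong (u ∷_) (vertices-▻ p a)

  vertices-split : ∀ {u v k} (w : Walk G u v (suc k)) →
    ∃ λ ps → vertices w ≡ u ∷ ps ++ [ v ] × length ps ≡ k
  vertices-split (a ◅ ε)           = [] , refl , refl
  vertices-split {u} (_◅_ {w = m} a w@(_ ◅ _)) with vertices-split w
  ... | ps , eq , len = m ∷ ps , cong (u ∷_) eq , cong suc len

  splitʷ : ∀ {u v k z} (w : Walk G u v k) → z ∈ vertices w →
    ∃ λ k₁ → ∃ λ k₂ → Walk G u z k₁ × Walk G z v k₂ × k₁ + k₂ ≡ k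
  splitʷ w       (here refl) = 0 , _ , ε , w , refl
  splitʷ (a ◅ w) (there z∈w) with splitʷ w z∈w
  ... | k₁ , k₂ , w₁ , w₂ , eq = suc k₁ , k₂ , a ◅ w₁ , w₂ , cong suc eq

  detour-length-suc : ∀ {u v k} (d : Detour G u v k) →
    suc (Detour.loop-length d) + suc (Detour.rest-length d) ≡ suc k
  detour-length-suc d =
    trans (+-suc (suc (Detour.loop-length d)) (Detour.rest-length d)) (cong suc (Detour.length-sum d))

  unique⊎detour : ∀ {u v k} (w : Walk G u v k) → Unique (vertices w) ⊎ Detour G u v k
  unique⊎detour ε = inj₁ ([] ∷ [])
  unique⊎detour {u} (a ◅ w) with unique⊎detour w
  ... | inj₂ d = inj₂ record
    { loop = Detour.loop d ; rest = a ◅ Detour.rest d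
    ; length-sum = detour-length-suc d }
  ... | inj₁ unique with u ∈ᴸ? vertices w
  ...   | no  u∉w = inj₁ (¬Any⇒All¬ (vertices w) u∉w ∷ unique)
  ...   | yes u∈w with splitʷ w u∈w
  ...     | _ , _ , w₁ , w₂ , eq = inj₂ record { loop = a ◅ w₁ ; rest = w₂ ; length-sum = cong suc eq }

  loop-shorter : ∀ {u v k} (d : Detour G u v k) → Detour.loop-length d < k
  loop-shorter d = ≤-trans (s≤s (m≤m+n _ _)) (≤-reflexive (Detour.length-sum d))

  rest-shorter : ∀ {u v k} (d : Detour G u v k) → Detour.rest-length d < k
  rest-shorter d = ≤-trans (s≤s (m≤n+m _ (Detour.loop-length d))) (≤-reflexive (Detour.length-sum d))

  odd-closed-walk⇒cycle : ∀ {c k x} → Walk G x x k → flips k c ≢ c → HasCycle G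
  odd-closed-walk⇒cycle {c} {k} = <-rec Odd⇒Cycle odd⇒cycle k
    where
    Odd⇒Cycle : ℕ → Set
    Odd⇒Cycle k = ∀ {x} → Walk G x x k → flips k c ≢ c → HasCycle G

    odd⇒cycle : ∀ k → (∀ {j} → j < k → Odd⇒Cycle j) → Odd⇒Cycle k
    odd⇒cycle _ _ ε odd = ⊥-elim (odd refl)
    odd⇒cycle (suc k) shorter (a ◅ w) odd with unique⊎detour w
    ... | inj₂ d with flips-odd-+ (suc (Detour.loop-length d)) (suc (Detour.rest-length d)) c
                        (subst (λ j → flips j c ≢ c) (sym (detour-length-suc d)) odd)
    ...   | inj₁ loop-odd = shorter (s≤s (loop-shorter d)) (Detour.loop d) loop-odd
    ...   | inj₂ rest-odd = shorter (s≤s (rest-shorter d)) (a ◅ Detour.rest d) rest-odd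
    -- a ◅ w with w free of repetitions is a cycle, once length 1 and 2 are excluded.
    odd⇒cycle _ _ (a ◅ ε) _ | inj₁ _ = ⊥-elim (Adj⇒≢ G a refl)
    odd⇒cycle _ _ (a ◅ b ◅ ε) odd | inj₁ _ = ⊥-elim (odd (opposite-involutive c))
    odd⇒cycle _ _ (a ◅ w@(b ◅ b′ ◅ w′)) _ | inj₁ unique =
      _ , _ , _ , later w′ , unique , subst (Linked (Adj G)) (vertices-▻ w a) (vertices-linked (w ▻ a))

  walk⇒path : ∀ {u v k} → u ≢ v → Walk G u v k →
    ∃ λ ps → IsPath G u v ps × Walk G u v (suc (length ps))
  walk⇒path {k = k} = <-rec Shortens shorten k
    where
    Shortens : ℕ → Set
    Shortens k = ∀ {u v} → u ≢ v → Walk G u v k → ∃ λ ps → IsPath G u v ps × Walk G u v (suc (length ps))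

    shorten : ∀ k → (∀ {j} → j < k → Shortens j) → Shortens k
    shorten _ shorter u≢v w with unique⊎detour w
    ... | inj₂ d = shorter (rest-shorter d) u≢v (Detour.rest d)
    shorten _ _ u≢v ε | inj₁ _ = ⊥-elim (u≢v refl)
    shorten _ _ {u} {v} _ w@(_ ◅ _) | inj₁ unique with vertices-split w
    ... | ps , eq , len =
      ps , (subst Unique eq unique , subst (Linked (Adj G)) eq (vertices-linked w)) ,
      subst (Walk G u v) (cong suc (sym len)) w

ProperColouring : ∀ {n} → Graph n → (Fin n → Colour) → Set
ProperColouring G f = ∀ x y → Adj G x y → f y ≡ opposite (f x)

proper-colours-differ : ∀ {n} (G : Graph n) {f} → ProperColouring G f → ∀ {x y} → Adj G x y → f x ≢ f y
proper-colours-differ _ {f} proper {x} {y} xy fx≡fy =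
  opposite-≢ (f x) (trans fx≡fy (proper x y xy))

walk-colour : ∀ {n} {G : Graph n} {f} → ProperColouring G f → ∀ {u v k} → Walk G u v k → f v ≡ flips k (f u)
walk-colour proper ε = refl
walk-colour {f = f} proper {u} (_◅_ {w = m} {k = k} a w) = begin
  f _                     ≡⟨ walk-colour proper w ⟩
  flips k (f m)           ≡⟨ cong (flips k) (proper u m a) ⟩
  flips k (opposite (f u)) ≡⟨ flips-opposite k (f u) ⟩
  opposite (flips k (f u)) ∎

-- Colourings of trees

module _ {n : ℕ} (T : Graph n) (T-connected : Connected T) where

  walk-between : ∀ u v → ∃ (Walk T u v)
  walk-between u v = walkIn⇒walk (T-connected u v tt tt)

  depth-colouring : Fin n → Fin n → Colour
  depth-colouring r x = flips (proj₁ (walk-between r x)) black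

  depth-colouring-proper : ¬ HasCycle T → ∀ r → ProperColouring T (depth-colouring r)
  depth-colouring-proper acyclic r x y xy = ≢⇒≡opposite λ same →
    acyclic (odd-closed-walk⇒cycle (r⇝x ++ʷ (xy ◅ reverseʷ r⇝y)) (odd same))
    where
    kx = proj₁ (walk-between r x)
    r⇝x = proj₂ (walk-between r x)
    ky = proj₁ (walk-between r y)
    r⇝y = proj₂ (walk-between r y)
    odd : flips kx black ≡ flips ky black → flips (kx + suc ky) black ≢ black
    odd same even = opposite-≢ black (trans (sym even) closing)
      where
      closing : flips (kx + suc ky) black ≡ opposite black
      closing = begin
        flips (kx + suc ky) black                   ≡⟨ flips-+ kx (suc ky) black ⟩
        flips kx (opposite (flips ky black))        ≡⟨ cong (λ c → flips kx (opposite c)) (sym same) ⟩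
        flips kx (opposite (flips kx black))        ≡⟨ flips-opposite kx _ ⟩
        opposite (flips kx (flips kx black))        ≡⟨ cong opposite (flips-involutive kx black) ⟩
        opposite black                              ∎

  proper-colouring-with : ¬ HasCycle T → ∀ r c → ∃ λ f → ProperColouring T f × f r ≡ c
  proper-colouring-with acyclic r c with depth-colouring r r ≟ᶜ c
  ... | yes fr≡c = depth-colouring r , depth-colouring-proper acyclic r , fr≡c
  ... | no  fr≢c = (λ x → opposite (depth-colouring r x)) ,
                   (λ x y xy → cong opposite (depth-colouring-proper acyclic r x y xy)) ,
                   sym (≢⇒≡opposite fr≢c)

  leaves-same-colour : IsEven T → ∀ {f} → ProperColouring T f → ∀ {a b} → Deg1 T a → Deg1 T b → f a ≡ f b
  leaves-same-colour even {f} proper {a} {b} a-leaf b-leaf with a ≟ b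
  ... | yes refl = refl
  ... | no  a≢b with walk⇒path a≢b (proj₂ (walk-between a b))
  ...   | ps , path , a⇝b = sym (trans (walk-colour proper a⇝b)
                              (flips-even _ (f a) (even a b a-leaf b-leaf a≢b ps path)))

  Deg1-⊑ : ∀ G → T ⊑ G → ∀ {x} → Deg1 G x → Deg1 T x
  Deg1-⊑ G T⊑G {x} (w , xw , only-w) with T-connected x w tt tt
  ... | here _ = ⊥-elim (Adj⇒≢ G xw refl)
  ... | step {w = z} _ xz _ =
    w , subst (Adj T x) (only-w z (T⊑G x z xz)) xz , λ y xy → only-w y (T⊑G x y xy)

module _ {n : ℕ} {G T : Graph n} (G-block : IsBlockGraph G) (T⊑G : T ⊑ G) (T-connected : Connected T) where

  IsPath-⊑ : ∀ {u v ps} → IsPath T u v ps → IsPath G u v ps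
  IsPath-⊑ (unique , linked) = unique , Linked.map (λ {x} {y} → T⊑G x y) linked

  monochromatic-maximal-clique⇒subsingleton : ∀ {f col B} → ProperColouring T f → MaximalClique G B →
    (∀ {y} → B y → f y ≡ col) → ∀ {u v} → B u → B v → u ≡ v
  monochromatic-maximal-clique⇒subsingleton {f} {col} {B} proper (B-clique , B-max) mono {u} {v} Bu Bv =
    decidable-stable (u ≟ v) distinct-impossible
    where
    no-tree-edge : ∀ {x y} → Adj T x y → B x → B y → ⊥
    no-tree-edge xy Bx By = proper-colours-differ T proper xy (trans (mono Bx) (sym (mono By)))

    -- The tree path from u to v closes with the edge uv to a cycle of G, whose block contains B and
    -- is a clique, hence equals B. So the tree neighbour q of u lies in B.
    distinct-impossible : u ≢ v → ⊥
    distinct-impossible u≢v with walk⇒path u≢v (proj₂ (walk-between T T-connected u v))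
    ... | []    , (_ , uv ∷ [-]) , _ = no-tree-edge uv Bu Bv
    ... | q ∷ qs , path@(_ , uq ∷ _) , _ =
      component-containing G (cycle-biconnected G (B-clique u v Bu Bv u≢v) (IsPath-⊑ {ps = q ∷ qs} path))
        λ (s , cycle⊆s , s-block) →
          let B⊆s = clique⊆component G s-block B-clique Bu Bv u≢v (cycle⊆s (inj₁ (inj₁ refl)))
                      (cycle⊆s (inj₁ (inj₂ refl)))
              Bq  = B-max ⟦ s ⟧ (λ _ → B⊆s) (G-block ⟦ s ⟧ s-block) q (cycle⊆s (inj₂ (here refl)))
          in no-tree-edge uq Bu Bq

-- Agreement of the procedure with a proper colouring

Agrees : ∀ {n} → (Fin n → Colour) → PartialColouring n → Set
Agrees f c = ∀ x k → c x ≡ just k → f x ≡ k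

another-vertex : ∀ {n} → 2 ≤ n → (v : Fin n) → ∃ λ w → w ≢ v
another-vertex (s≤s (s≤s _)) Fin.zero    = Fin.suc Fin.zero , λ ()
another-vertex (s≤s (s≤s _)) (Fin.suc _) = Fin.zero , λ ()

module _ {n : ℕ} (G T : Graph n) (two-vertices : 2 ≤ n) (G-connected : Connected G) (G-block : IsBlockGraph G)
         (T⊑G : T ⊑ G) (T-connected : Connected T) {f : Fin n → Colour} (proper : ProperColouring T f) where

  step-agrees : ∀ {c c′} → Agrees f c → Step G c c′ → Agrees f c′
  step-agrees agrees (B , v , col , (B-max , Bv , _ , others) , c′v , unchanged) x k c′x with x ≟ v
  ... | no  x≢v = agrees x k (trans (sym (unchanged x x≢v)) c′x)
  ... | yes refl = trans fv≡opposite (just-injective (trans (sym c′v) c′x))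
    where
    monochromatic : f v ≢ opposite col → ∀ {y} → B y → f y ≡ col
    monochromatic fv≢ {y} By with y ≟ v
    ... | yes refl = trans (≢⇒≡opposite (λ eq → fv≢ (sym eq))) (opposite-involutive col)
    ... | no  y≢v  = agrees y col (others y By y≢v)

    fv≡opposite : f v ≡ opposite col
    fv≡opposite = decidable-stable (f v ≟ᶜ opposite col) λ fv≢ →
      maximal-clique-not-singleton G G-connected (proj₂ (another-vertex two-vertices v)) B-max Bv
        (λ Bu → monochromatic-maximal-clique⇒subsingleton G-block T⊑G T-connected proper B-max
                  (monochromatic fv≢) Bu Bv)

  run-agrees : ∀ {c c′} → Agrees f c → Run G c c′ → Agrees f c′
  run-agrees agrees done        = agrees
  run-agrees agrees (next s run) = run-agrees (step-agrees agrees s) run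

module _ {n : ℕ} (G T : Graph n) (T⊑G : T ⊑ G) (T-connected : Connected T) (T-acyclic : ¬ HasCycle T)
         (T-even : IsEven T) where

  coloured⇒leaf : ∀ {c} → InitialColouring G c → ∀ {x k} → c x ≡ just k → ¬ ¬ Deg1 G x
  coloured⇒leaf initial {x} cx not-leaf with trans (sym cx) (proj₂ (initial x) not-leaf)
  ... | ()

  -- The root r matters only when G has no leaf, so that nothing is coloured initially.
  initial-agrees : ∀ {c} → InitialColouring G c → Fin n → ¬ ¬ (∃ λ f → ProperColouring T f × Agrees f c)
  initial-agrees {c} initial r = ¬¬-excluded-middle {A = ∃ (Deg1 G)} >>= λ where
    (no no-leaf) →
      let f , proper , _ = proper-colouring-with T T-connected T-acyclic r black
      in return (f , proper , λ x k cx → ⊥-elim (coloured⇒leaf initial cx λ x-leaf → no-leaf (x , x-leaf)))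
    (yes (z , z-leaf)) →
      let f , proper , fz≡black = proper-colouring-with T T-connected T-acyclic z black
      in return (f , proper , λ x k cx → decidable-stable (f x ≟ᶜ k) (¬¬-map (λ x-leaf → begin
           f x     ≡⟨ leaves-same-colour T T-connected T-even proper
                        (Deg1-⊑ T T-connected G T⊑G x-leaf) (Deg1-⊑ T T-connected G T⊑G z-leaf) ⟩
           f z     ≡⟨ fz≡black ⟩
           black   ≡⟨ just-injective (trans (sym (proj₁ (initial x) x-leaf)) cx) ⟩
           k       ∎) (coloured⇒leaf initial cx)))

corollary13 : (n : ℕ) → n ≥ 3 → (G : Graph n) → Connected G → IsBlockGraph G →
    (c' : PartialColouring n) → IsOutput G c' →
    (T : Graph n) → IsSpanningEvenTree G T →
    ∀ u v → Adj T u v → EdgeOfG' G c' u v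
corollary13 n n≥3 G G-connected G-block c′ (c , c-initial , run , _)
            T (T⊑G , (T-connected , T-acyclic) , T-even) u v uv =
  T⊑G u v uv , λ (col , c′u , c′v) →
    initial-agrees G T T⊑G T-connected T-acyclic T-even c-initial u λ (f , proper , agrees) →
      let agrees′ = run-agrees G T (≤-trans (n≤1+n 2) n≥3) G-connected G-block T⊑G T-connected proper
                      agrees run
      in proper-colours-differ T proper uv (trans (agrees′ u col c′u) (sym (agrees′ v col c′v)))
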